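{- Let $\mathfrak g\ge1$, $r\ge0$ and integers $1<m_1\le\dots\le m_r$. Let $\Gamma$ be the group with generators $x_1,\dots,x_r,a_1,\dots,a_{\mathfrak g}$ and relations $\prod_{i=1}^r x_i\prod_{k=1}^{\mathfrak g}a_k^2=1$, $x_i^{m_i}=1$. Then for every integer $d\ge1$ the number of order-preserving homomorphisms $\Gamma\to\mathbb{Z}_d$ is $$\mathrm{Hom}_o(\Gamma,\mathbb{Z}_d)=\begin{cases} d^{\mathfrak g-1}\prod_{i=1}^r\phi(m_i) & \text{if } d \text{ is odd and } m_i\mid d \text{ for all } i,\\ 2d^{\mathfrak g-1}\prod_{i=1}^r\phi(m_i) & \text{if } d \text{ is even, } m_i\mid d \text{ for all } i, \text{ and } \sum_{i=1}^r d/m_i \text{ is even},\\ 0 & \text{otherwise.}\end{cases}$$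
   Context: $\Gamma$ is the fundamental group of the non-orientable orbifold without boundary with $\mathfrak g$ crosscaps and $r$ branch points of indices $m_i$. A homomorphism $\psi:\Gamma\to\mathbb{Z}_d$ is order-preserving if $\psi(x_i)$ has order exactly $m_i$ for every $i$. $\phi$ is Euler's totient function. -}

module Defs where

open import Data.Nat using (ℕ; zero; suc; _+_; _*_; _<_; _%_; NonZero)
open import Data.Nat.Properties using (_≟_; _<?_)
open import Data.Nat.GCD using (gcd)
open import Data.Nat.Divisibility using (_∣_; _∣?_; quotient)
open import Data.Fin using (Fin; toℕ)
open import Data.Fin.Properties using (all?)
open import Data.Vec using (Vec; []; _∷_; lookup)
import Data.Vec as Vec
open import Data.List using (List; [_]; map; concatMap; filter; length; upTo; allFin; cartesianProduct)
open import Data.Product using (_×_; _,_)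
open import Relation.Nullary using (¬_; Dec; _×-dec_; ¬?)
open import Relation.Unary using (Decidable)
open import Relation.Binary.PropositionalEquality using (_≡_)

φ : ℕ → ℕ
φ m = length (filter (λ k → gcd k m ≟ 1) (map suc (upTo m)))

prodVec : ∀ {n} → Vec ℕ n → ℕ
prodVec = Vec.foldr _ _*_ 1

allVecs : (n d : ℕ) → List (Vec (Fin d) n)
allVecs zero    d = [ [] ]
allVecs (suc n) d = concatMap (λ i → map (i ∷_) (allVecs n d)) (allFin d)

-- Z_d is modelled as Fin d with arithmetic modulo d on representatives.
-- Element y ∈ Z_d has order exactly m:  m·y = 0, and k·y ≠ 0 for 0 < k < m.
HasOrder : (d : ℕ) .{{_ : NonZero d}} → Fin d → ℕ → Set
HasOrder d y m =
  ((m * toℕ y) % d ≡ 0) × (∀ (k : Fin m) → 0 < toℕ k → ¬ ((toℕ k * toℕ y) % d ≡ 0))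

hasOrder? : (d : ℕ) .{{_ : NonZero d}} → (y : Fin d) → (m : ℕ) → Dec (HasOrder d y m)
hasOrder? d y m =
  (((m * toℕ y) % d) ≟ 0) ×-dec all? (λ k → decImp (0 <? toℕ k) (¬? (((toℕ k * toℕ y) % d) ≟ 0)))
  where
  open import Relation.Nullary using (yes; no)
  open import Relation.Nullary.Decidable using (_→-dec_)
  decImp = _→-dec_

-- A homomorphism Γ → Z_d (Γ = ⟨x₁…x_r, a₁…a_g | x₁⋯x_r a₁²⋯a_g² = 1, x_i^{m_i} = 1⟩)
-- is exactly an assignment of the generators (xs , as) satisfying the relations.
IsHom : (d : ℕ) .{{_ : NonZero d}} → {r g : ℕ} → Vec ℕ r →
        Vec (Fin d) r × Vec (Fin d) g → Set
IsHom d {r} {g} ms (xs , as) =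
  ((Vec.sum (Vec.map toℕ xs) + Vec.sum (Vec.map (λ a → 2 * toℕ a) as)) % d ≡ 0)
  × (∀ (i : Fin r) → ((lookup ms i * toℕ (lookup xs i)) % d ≡ 0))

IsOrdPresHom : (d : ℕ) .{{_ : NonZero d}} → {r g : ℕ} → Vec ℕ r →
               Vec (Fin d) r × Vec (Fin d) g → Set
IsOrdPresHom d {r} ms (xs , as) =
  IsHom d ms (xs , as) × (∀ (i : Fin r) → HasOrder d (lookup xs i) (lookup ms i))

isOrdPresHom? : (d : ℕ) .{{_ : NonZero d}} → {r g : ℕ} → (ms : Vec ℕ r) →
                Decidable (IsOrdPresHom d {r} {g} ms)
isOrdPresHom? d ms (xs , as) =
  (((_ % d) ≟ 0) ×-dec all? (λ i → ((_ % d) ≟ 0)))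
  ×-dec all? (λ i → hasOrder? d (lookup xs i) (lookup ms i))

homO : (g : ℕ) {r : ℕ} → Vec ℕ r → (d : ℕ) .{{_ : NonZero d}} → ℕ
homO g {r} ms d =
  length (filter (isOrdPresHom? d {r} {g} ms) (cartesianProduct (allVecs r d) (allVecs g d)))

sumQuot : {r : ℕ} (ms : Vec ℕ r) (d : ℕ) → (∀ (i : Fin r) → lookup ms i ∣ d) → ℕ
sumQuot {r} ms d div = Vec.sum (Vec.tabulate (λ i → quotient (div i)))

{-# OPTIONS --safe #-}
-- A homomorphism Γ → ℤ_d is a pair x ∈ ℤ_d^r, a ∈ ℤ_d^g with Σ x + 2 Σ a ≡ 0. For fixed x and
-- a_2, …, a_g, the coordinate a_1 must solve 2t ≡ −s (mod d), where s = Σ x + 2(a_2 + ⋯ + a_g).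
-- The number of solutions is invariant under s ↦ s + 2 and s ↦ s + d and sums to d over a period,
-- so it is 1 when d is odd, and 2 or 0 according to the parity of s (that is, of Σ x) when d is even.
-- An element of order m in ℤ_d exists only if m ∣ d, and then the elements of order m are the
-- k·(d/m) with k coprime to m: φ(m) of them, all of the parity of d/m when d is even.
-- Hence Σ x ≡ Σ d/m_i (mod 2) whenever each x_i has order m_i.
module Submission where

open import Defs
open import Data.Bool using (true; false)
open import Data.Empty using (⊥-elim)
open import Data.Fin using (Fin; toℕ; fromℕ<; zero; suc) renaming (_≤_ to _≤ᶠ_)
open import Data.Fin.Properties using (all?; toℕ-fromℕ<; toℕ<n)
open import Data.List
  using (List; []; _∷_; _++_; map; concatMap; filter; length; applyUpTo; upTo; tabulate; allFin; cartesianProduct)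
open import Data.List.Properties using (map-tabulate; map-upTo)
open import Data.Nat
open import Data.Nat.Coprimality
  using (Coprime; coprime-divisor; coprime⇒gcd≡1; gcd≡1⇒coprime) renaming (sym to coprime-sym)
open import Data.Nat.DivMod
open import Data.Nat.Divisibility
open import Data.Nat.GCD using (gcd)
open import Data.Nat.Primality using (euclidsLemma; prime[2])
open import Data.Nat.Properties
open import Algebra.Properties.CommutativeSemigroup +-commutativeSemigroup using (interchange; xy∙z≈xz∙y)
open import Data.Nat.Tactic.RingSolver using (solve-∀)
open import Data.Product using (_×_; _,_; proj₁)
open import Data.Sum using (inj₁; inj₂)
open import Data.Vec using (Vec; []; _∷_; lookup)
import Data.Vec as Vec
open import Function using (_∘_; _⇔_; mk⇔; Equivalence)
open import Function.Construct.Composition using (_⇔-∘_)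
open import Level using (Level)
open import Relation.Binary.PropositionalEquality
open import Relation.Nullary using (Dec; _because_; yes; no; ¬_; _×-dec_; ¬?)
open import Relation.Nullary.Decidable using (_→-dec_)
open import Relation.Unary using (Decidable)
open ≡-Reasoning

private variable
  ℓ ℓ′ : Level
  A B : Set ℓ
  P : Set ℓ

𝟙 : Dec P → ℕ
𝟙 (true  because _) = 1
𝟙 (false because _) = 0

𝟙-yes : P → (P? : Dec P) → 𝟙 P? ≡ 1
𝟙-yes _ (yes _)  = refl
𝟙-yes p (no ¬p) = ⊥-elim (¬p p)

𝟙-no : ¬ P → (P? : Dec P) → 𝟙 P? ≡ 0
𝟙-no ¬p (yes p) = ⊥-elim (¬p p)
𝟙-no _  (no _)  = refl

𝟙-cong : {P : Set ℓ} {Q : Set ℓ′} → P ⇔ Q → (P? : Dec P) (Q? : Dec Q) → 𝟙 P? ≡ 𝟙 Q?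
𝟙-cong P⇔Q (yes p)  Q? = sym (𝟙-yes (Equivalence.to P⇔Q p) Q?)
𝟙-cong P⇔Q (no ¬p) Q? = sym (𝟙-no (¬p ∘ Equivalence.from P⇔Q) Q?)

𝟙-×-dec : {P : Set ℓ} {Q : Set ℓ′} (P? : Dec P) (Q? : Dec Q) → 𝟙 (P? ×-dec Q?) ≡ 𝟙 P? * 𝟙 Q?
𝟙-×-dec (yes _) (yes _) = refl
𝟙-×-dec (yes _) (no _)  = refl
𝟙-×-dec (no _)  _       = refl

∑ : List A → (A → ℕ) → ℕ
∑ []       f = 0
∑ (x ∷ xs) f = f x + ∑ xs f

infix 5 ∑
syntax ∑ xs (λ x → e) = ∑[ x ∈ xs ] e

length-filter≡∑𝟙 : {P : A → Set ℓ} (P? : Decidable P) (xs : List A) →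
                   length (filter P? xs) ≡ ∑[ x ∈ xs ] 𝟙 (P? x)
length-filter≡∑𝟙 P? []       = refl
length-filter≡∑𝟙 P? (x ∷ xs) with P? x
... | yes _ = cong suc (length-filter≡∑𝟙 P? xs)
... | no  _ = length-filter≡∑𝟙 P? xs

∑-cong : ∀ (xs : List A) {f g : A → ℕ} → (∀ x → f x ≡ g x) → ∑ xs f ≡ ∑ xs g
∑-cong []       f≡g = refl
∑-cong (x ∷ xs) f≡g = cong₂ _+_ (f≡g x) (∑-cong xs f≡g)

∑-++ : ∀ (xs ys : List A) f → ∑ (xs ++ ys) f ≡ ∑ xs f + ∑ ys f
∑-++ []       ys f = refl
∑-++ (x ∷ xs) ys f = trans (cong (f x +_) (∑-++ xs ys f)) (sym (+-assoc (f x) _ _))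

∑-map : ∀ (h : A → B) xs f → ∑ (map h xs) f ≡ ∑[ x ∈ xs ] f (h x)
∑-map h []       f = refl
∑-map h (x ∷ xs) f = cong (f (h x) +_) (∑-map h xs f)

∑-concatMap : ∀ (h : A → List B) xs f → ∑ (concatMap h xs) f ≡ ∑[ x ∈ xs ] ∑ (h x) f
∑-concatMap h []       f = refl
∑-concatMap h (x ∷ xs) f =
  trans (∑-++ (h x) (concatMap h xs) f) (cong (∑ (h x) f +_) (∑-concatMap h xs f))

∑-cartesianProduct : ∀ (xs : List A) (ys : List B) f →
                     ∑ (cartesianProduct xs ys) f ≡ ∑[ x ∈ xs ] ∑[ y ∈ ys ] f (x , y)
∑-cartesianProduct []       ys f = refl
∑-cartesianProduct (x ∷ xs) ys f = trans (∑-++ (map (x ,_) ys) _ f)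
  (cong₂ _+_ (∑-map (x ,_) ys f) (∑-cartesianProduct xs ys f))

∑-*ˡ : ∀ (xs : List A) c f → ∑[ x ∈ xs ] c * f x ≡ c * ∑ xs f
∑-*ˡ []       c f = sym (*-zeroʳ c)
∑-*ˡ (x ∷ xs) c f = trans (cong (c * f x +_) (∑-*ˡ xs c f)) (sym (*-distribˡ-+ c (f x) _))

∑-𝟙-* : {P : A → Set ℓ} (P? : Decidable P) (xs : List A) {f : A → ℕ} (c : ℕ) →
        (∀ x → P x → f x ≡ c) → ∑[ x ∈ xs ] 𝟙 (P? x) * f x ≡ c * (∑[ x ∈ xs ] 𝟙 (P? x))
∑-𝟙-* P? xs {f} c f≡c = trans (∑-cong xs 𝟙*f≡c*𝟙) (∑-*ˡ xs c (𝟙 ∘ P?))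
  where
  𝟙*f≡c*𝟙 : ∀ x → 𝟙 (P? x) * f x ≡ c * 𝟙 (P? x)
  𝟙*f≡c*𝟙 x with P? x
  ... | yes p = trans (+-identityʳ (f x)) (trans (f≡c x p) (sym (*-identityʳ c)))
  ... | no  _ = sym (*-zeroʳ c)

∑-allVecs-suc : ∀ n {d} (h : Vec (Fin d) (suc n) → ℕ) →
                ∑ (allVecs (suc n) d) h ≡ ∑[ i ∈ allFin d ] ∑[ v ∈ allVecs n d ] h (i ∷ v)
∑-allVecs-suc n {d} h = trans (∑-concatMap _ (allFin d) h)
  (∑-cong (allFin d) (λ i → ∑-map (i ∷_) (allVecs n d) h))

∑< : ℕ → (ℕ → ℕ) → ℕ
∑< zero    f = 0
∑< (suc n) f = f 0 + ∑< n (f ∘ suc)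

infix 5 ∑<
syntax ∑< n (λ i → e) = ∑[ i < n ] e

∑<-cong : ∀ n {f g : ℕ → ℕ} → (∀ i → f i ≡ g i) → ∑< n f ≡ ∑< n g
∑<-cong zero    f≡g = refl
∑<-cong (suc n) f≡g = cong₂ _+_ (f≡g 0) (∑<-cong n (f≡g ∘ suc))

∑<-vanishing : ∀ n {f : ℕ → ℕ} → (∀ {i} → i < n → f i ≡ 0) → ∑< n f ≡ 0
∑<-vanishing zero    f≡0 = refl
∑<-vanishing (suc n) f≡0 = cong₂ _+_ (f≡0 z<s) (∑<-vanishing n (f≡0 ∘ s<s))

∑<-const : ∀ n c → ∑[ i < n ] c ≡ n * c
∑<-const zero    c = refl
∑<-const (suc n) c = cong (c +_) (∑<-const n c)

∑<-*ʳ : ∀ n f c → ∑[ i < n ] f i * c ≡ ∑< n f * c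
∑<-*ʳ zero    f c = refl
∑<-*ʳ (suc n) f c =
  trans (cong (f 0 * c +_) (∑<-*ʳ n (f ∘ suc) c)) (sym (*-distribʳ-+ c (f 0) _))

∑<-+ : ∀ n f g → ∑[ i < n ] (f i + g i) ≡ ∑< n f + ∑< n g
∑<-+ zero    f g = refl
∑<-+ (suc n) f g =
  trans (cong (f 0 + g 0 +_) (∑<-+ n (f ∘ suc) (g ∘ suc))) (interchange (f 0) (g 0) _ _)

∑<-comm : ∀ m n (f : ℕ → ℕ → ℕ) → ∑[ i < m ] ∑[ j < n ] f i j ≡ ∑[ j < n ] ∑[ i < m ] f i j
∑<-comm zero    n f = sym (∑<-vanishing n (λ _ → refl))
∑<-comm (suc m) n f =
  trans (cong (∑< n (f 0) +_) (∑<-comm m n (f ∘ suc))) (sym (∑<-+ n (f 0) _))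

∑<-suc : ∀ n f → ∑< (suc n) f ≡ ∑< n f + f n
∑<-suc zero    f = +-comm (f 0) 0
∑<-suc (suc n) f = trans (cong (f 0 +_) (∑<-suc n (f ∘ suc))) (sym (+-assoc (f 0) _ _))

∑<-split : ∀ m n f → ∑< (m + n) f ≡ ∑< m f + (∑[ i < n ] f (m + i))
∑<-split zero    n f = refl
∑<-split (suc m) n f = trans (cong (f 0 +_) (∑<-split m n (f ∘ suc))) (sym (+-assoc (f 0) _ _))

∑<-rotate : ∀ n {f : ℕ → ℕ} → (∀ x → f (x + n) ≡ f x) → ∀ a → ∑[ t < n ] f (a + t) ≡ ∑< n f
∑<-rotate n         f-per zero    = refl
∑<-rotate n {f} f-per (suc a) = trans (∑<-rotate n (f-per ∘ suc) a) rotate-once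
  where
  rotate-once : ∑< n (f ∘ suc) ≡ ∑< n f
  rotate-once = +-cancelˡ-≡ (f 0) _ _ (begin
    f 0 + ∑< n (f ∘ suc) ≡⟨ ∑<-suc n f ⟩
    ∑< n f + f n         ≡⟨ cong (∑< n f +_) (f-per 0) ⟩
    ∑< n f + f 0         ≡⟨ +-comm _ (f 0) ⟩
    f 0 + ∑< n f         ∎)

∑<-periodic : ∀ e p {f : ℕ → ℕ} → (∀ x → f (p + x) ≡ f x) → ∑< (e * p) f ≡ e * ∑< p f
∑<-periodic zero    p f-per = refl
∑<-periodic (suc e) p {f} f-per = begin
  ∑< (p + e * p) f                   ≡⟨ ∑<-split p (e * p) f ⟩
  ∑< p f + (∑[ i < e * p ] f (p + i))  ≡⟨ cong (∑< p f +_) (∑<-cong (e * p) f-per) ⟩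
  ∑< p f + ∑< (e * p) f              ≡⟨ cong (∑< p f +_) (∑<-periodic e p f-per) ⟩
  ∑< p f + e * ∑< p f                ∎

∑<-multiples : ∀ m q .{{_ : NonZero q}} {f : ℕ → ℕ} → (∀ y → ¬ q ∣ y → f y ≡ 0) →
               ∑< (m * q) f ≡ ∑[ k < m ] f (k * q)
∑<-multiples zero    q                f-off = refl
∑<-multiples (suc m) q@(suc q-1) {f} f-off = begin
  ∑< (q + m * q) f                    ≡⟨ ∑<-split q (m * q) f ⟩
  ∑< q f + (∑[ y < m * q ] f (q + y))   ≡⟨ cong₂ _+_ first-block (∑<-multiples m q f-off-shifted) ⟩
  f 0 + (∑[ k < m ] f (q + k * q))    ∎
  where
  first-block : ∑< q f ≡ f 0
  first-block = trans (cong (f 0 +_) (∑<-vanishing q-1 (λ i<q-1 → f-off _ (>⇒∤ (s<s i<q-1)))))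
                      (+-identityʳ (f 0))
  f-off-shifted : ∀ y → ¬ q ∣ y → f (q + y) ≡ 0
  f-off-shifted y q∤y = f-off (q + y) (λ q∣q+y → q∤y (∣m+n∣m⇒∣n q∣q+y ∣-refl))

∑-upTo : ∀ n f → ∑[ i ∈ upTo n ] f i ≡ ∑< n f
∑-upTo zero    f = refl
∑-upTo (suc n) f = cong (f 0 +_) (begin
  ∑ (applyUpTo suc n) f      ≡⟨ cong (λ xs → ∑ xs f) (sym (map-upTo suc n)) ⟩
  ∑ (map suc (upTo n)) f     ≡⟨ ∑-map suc (upTo n) f ⟩
  ∑[ i ∈ upTo n ] f (suc i)  ≡⟨ ∑-upTo n (f ∘ suc) ⟩
  ∑< n (f ∘ suc)             ∎)

∑-allFin : ∀ n f → ∑[ i ∈ allFin n ] f (toℕ i) ≡ ∑< n f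
∑-allFin zero    f = refl
∑-allFin (suc n) f = cong (f 0 +_) (begin
  ∑ (tabulate {n = n} suc) (f ∘ toℕ)
    ≡⟨ cong (λ xs → ∑ xs (f ∘ toℕ)) (map-tabulate {n = n} (λ i → i) suc) ⟨
  ∑ (map suc (allFin n)) (f ∘ toℕ)   ≡⟨ ∑-map suc (allFin n) (f ∘ toℕ) ⟩
  ∑[ i ∈ allFin n ] f (suc (toℕ i))  ≡⟨ ∑-allFin n (f ∘ suc) ⟩
  ∑< n (f ∘ suc)                     ∎)

¬2∣n⇒n%2≡1 : ∀ {n} → ¬ 2 ∣ n → n % 2 ≡ 1
¬2∣n⇒n%2≡1 {n} 2∤n with n % 2 in n%2≡r | m%n<n n 2
... | 0           | _ = ⊥-elim (2∤n (m%n≡0⇒n∣m n 2 n%2≡r))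
... | 1           | _ = refl
... | suc (suc _) | s<s (s<s ())

¬2∣m⇒[m*n]%2≡n%2 : ∀ {m} n → ¬ 2 ∣ m → (m * n) % 2 ≡ n % 2
¬2∣m⇒[m*n]%2≡n%2 {m} n 2∤m = begin
  (m * n) % 2              ≡⟨ %-distribˡ-* m n 2 ⟩
  (m % 2 * (n % 2)) % 2    ≡⟨ cong (λ r → (r * (n % 2)) % 2) (¬2∣n⇒n%2≡1 2∤m) ⟩
  (1 * (n % 2)) % 2        ≡⟨ cong (_% 2) (*-identityˡ (n % 2)) ⟩
  n % 2 % 2                ≡⟨ m%n%n≡m%n n 2 ⟩
  n % 2                    ∎

%-cong-+ : ∀ {m m′ n n′} o .{{_ : NonZero o}} → m % o ≡ m′ % o → n % o ≡ n′ % o →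
           (m + n) % o ≡ (m′ + n′) % o
%-cong-+ {m} {m′} {n} {n′} o m≡m′ n≡n′ = begin
  (m + n) % o              ≡⟨ %-distribˡ-+ m n o ⟩
  (m % o + n % o) % o      ≡⟨ cong₂ (λ a b → (a + b) % o) m≡m′ n≡n′ ⟩
  (m′ % o + n′ % o) % o    ≡⟨ %-distribˡ-+ m′ n′ o ⟨
  (m′ + n′) % o            ∎

%-≡⇒∣⇔ : ∀ {m n} o .{{_ : NonZero o}} → m % o ≡ n % o → o ∣ m ⇔ o ∣ n
%-≡⇒∣⇔ {m} {n} o m≡n = mk⇔
  (λ o∣m → m%n≡0⇒n∣m n o (trans (sym m≡n) (n∣m⇒m%n≡0 m o o∣m)))
  (λ o∣n → m%n≡0⇒n∣m m o (trans m≡n (n∣m⇒m%n≡0 n o o∣n)))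

coprime⇔annihilator-free : ∀ {k m} → 1 < m → Coprime k m ⇔ (∀ {a} → 0 < a → a < m → ¬ m ∣ a * k)
coprime⇔annihilator-free {k} {m} 1<m = mk⇔ annihilator-free coprime
  where
  annihilator-free : Coprime k m → ∀ {a} → 0 < a → a < m → ¬ m ∣ a * k
  annihilator-free k⊥m {a} 0<a a<m m∣ak =
    >⇒∤ {{>-nonZero 0<a}} a<m (coprime-divisor (coprime-sym k⊥m) (subst (m ∣_) (*-comm a k) m∣ak))

  m≢0 : m ≢ 0
  m≢0 m≡0 = n≮0 (subst (1 <_) m≡0 1<m)

  coprime : (∀ {a} → 0 < a → a < m → ¬ m ∣ a * k) → Coprime k m
  coprime free {zero}          (_   , divides a m≡a*0)         = ⊥-elim (m≢0 (trans m≡a*0 (*-zeroʳ a)))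
  coprime free {suc zero}      _                               = refl
  coprime free {suc (suc i)}   (_   , divides zero m≡0)        = ⊥-elim (m≢0 m≡0)
  coprime free {i@(suc (suc _))} (i∣k , divides a@(suc _) m≡a*i) =
    ⊥-elim (free z<s a<m (subst (_∣ a * k) (sym m≡a*i) (*-monoʳ-∣ a i∣k)))
    where
    a<m : a < m
    a<m = subst (a <_) (sym m≡a*i) (m<m*n a i (s<s (s<s z≤n)))

-- `HasOrder d y m` is `HasOrderℕ d (toℕ y) m` by definition.
HasOrderℕ : (d : ℕ) .{{_ : NonZero d}} → ℕ → ℕ → Set
HasOrderℕ d n m = ((m * n) % d ≡ 0) × (∀ (k : Fin m) → 0 < toℕ k → ¬ ((toℕ k * n) % d ≡ 0))

hasOrderℕ? : (d : ℕ) .{{_ : NonZero d}} → ∀ n m → Dec (HasOrderℕ d n m)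
hasOrderℕ? d n m =
  ((m * n) % d ≟ 0) ×-dec all? (λ k → (0 <? toℕ k) →-dec ¬? ((toℕ k * n) % d ≟ 0))

module _ {d n m : ℕ} .{{_ : NonZero d}} where

  order-annihilates : HasOrderℕ d n m → d ∣ m * n
  order-annihilates (mn%d≡0 , _) = m%n≡0⇒n∣m _ d mn%d≡0

  order-minimal : HasOrderℕ d n m → ∀ {k} → 0 < k → k < m → ¬ d ∣ k * n
  order-minimal (_ , minimal) {k} 0<k k<m d∣kn = minimal (fromℕ< k<m)
    (subst (0 <_) (sym (toℕ-fromℕ< k<m)) 0<k)
    (subst (λ j → (j * n) % d ≡ 0) (sym (toℕ-fromℕ< k<m)) (n∣m⇒m%n≡0 _ d d∣kn))

  hasOrder-intro : d ∣ m * n → (∀ {k} → 0 < k → k < m → ¬ d ∣ k * n) → HasOrderℕ d n m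
  hasOrder-intro d∣mn minimal = n∣m⇒m%n≡0 _ d d∣mn ,
    λ k 0<k kn%d≡0 → minimal 0<k (toℕ<n k) (m%n≡0⇒n∣m _ d kn%d≡0)

  -- d ∣ (d % m) * n, so d % m would be a smaller positive annihilator of n.
  order∣modulus : .{{m≢0 : NonZero m}} → HasOrderℕ d n m → m ∣ d
  order∣modulus o with d % m ≟ 0
  ... | yes d%m≡0 = m%n≡0⇒n∣m d m d%m≡0
  ... | no  d%m≢0 = ⊥-elim (order-minimal o (n≢0⇒n>0 d%m≢0) (m%n<n d m) d∣[d%m]*n)
    where
    d*n≡ : d * n ≡ d / m * (m * n) + d % m * n
    d*n≡ = trans (cong (_* n) (m≡m%n+[m/n]*n d m)) (rearrange (d % m) (d / m) m n)
      where
      rearrange : ∀ r q m n → (r + q * m) * n ≡ q * (m * n) + r * n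
      rearrange = solve-∀
    d∣[d%m]*n : d ∣ d % m * n
    d∣[d%m]*n = ∣m+n∣m⇒∣n (subst (d ∣_) d*n≡ (∣m⇒∣m*n n ∣-refl))
                          (∣n⇒∣m*n (d / m) (order-annihilates o))

module _ {q m : ℕ} .{{_ : NonZero (q * m)}} where

  private instance
    q≢0 : NonZero q
    q≢0 = m*n≢0⇒m≢0 q

  order⇒multiple-of-quotient : ∀ {n} → HasOrderℕ (q * m) n m → q ∣ n
  order⇒multiple-of-quotient {n} o = *-cancelʳ-∣ m {{m*n≢0⇒n≢0 q}}
    (subst (q * m ∣_) (*-comm m n) (order-annihilates o))

  q*m∣a*[k*q]⇔m∣a*k : ∀ {a k} → q * m ∣ a * (k * q) ⇔ m ∣ a * k
  q*m∣a*[k*q]⇔m∣a*k {a} {k} = mk⇔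
    (λ qm∣akq → *-cancelʳ-∣ q (subst₂ _∣_ (*-comm q m) (sym (*-assoc a k q)) qm∣akq))
    (λ m∣ak → subst₂ _∣_ (*-comm m q) (*-assoc a k q) (*-monoˡ-∣ q m∣ak))

  hasOrder[k*q]⇔coprime : ∀ {k} → 1 < m → HasOrderℕ (q * m) (k * q) m ⇔ Coprime k m
  hasOrder[k*q]⇔coprime {k} 1<m = mk⇔ coprime hasOrder
    where
    open Equivalence
    free : Coprime k m ⇔ (∀ {a} → 0 < a → a < m → ¬ m ∣ a * k)
    free = coprime⇔annihilator-free 1<m
    coprime : HasOrderℕ (q * m) (k * q) m → Coprime k m
    coprime o = from free λ {a} 0<a a<m m∣ak →
      order-minimal o 0<a a<m (from (q*m∣a*[k*q]⇔m∣a*k {a} {k}) m∣ak)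
    hasOrder : Coprime k m → HasOrderℕ (q * m) (k * q) m
    hasOrder k⊥m = hasOrder-intro (divides k (m*[k*q]≡k*[q*m] m k q))
      λ {a} 0<a a<m qm∣akq → to free k⊥m 0<a a<m (to (q*m∣a*[k*q]⇔m∣a*k {a} {k}) qm∣akq)
      where
      m*[k*q]≡k*[q*m] : ∀ m k q → m * (k * q) ≡ k * (q * m)
      m*[k*q]≡k*[q*m] = solve-∀

φ≡∑[gcd≡1] : ∀ {m} → 1 < m → φ m ≡ ∑[ k < m ] 𝟙 (gcd k m ≟ 1)
φ≡∑[gcd≡1] {m} 1<m = begin
  φ m                                         ≡⟨ length-filter≡∑𝟙 _ (map suc (upTo m)) ⟩
  ∑[ k ∈ map suc (upTo m) ] 𝟙 (gcd k m ≟ 1)  ≡⟨ ∑-map suc (upTo m) _ ⟩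
  ∑[ k ∈ upTo m ] coprime (suc k)             ≡⟨ ∑-upTo m (coprime ∘ suc) ⟩
  ∑< m (coprime ∘ suc)                        ≡⟨ cong (_+ ∑< m (coprime ∘ suc)) (coprime-multiple (m ∣0)) ⟨
  coprime 0 + ∑< m (coprime ∘ suc)            ≡⟨ ∑<-suc m coprime ⟩
  ∑< m coprime + coprime m                    ≡⟨ cong (∑< m coprime +_) (coprime-multiple ∣-refl) ⟩
  ∑< m coprime + 0                            ≡⟨ +-identityʳ _ ⟩
  ∑< m coprime                                ∎
  where
  coprime : ℕ → ℕ
  coprime k = 𝟙 (gcd k m ≟ 1)
  coprime-multiple : ∀ {k} → m ∣ k → coprime k ≡ 0
  coprime-multiple m∣k = 𝟙-no (λ gcd≡1 → >⇒≢ 1<m (gcd≡1⇒coprime gcd≡1 (m∣k , ∣-refl))) _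

∑[hasOrder]≡φ : ∀ {d m} .{{_ : NonZero d}} → 1 < m → m ∣ d → ∑[ n < d ] 𝟙 (hasOrderℕ? d n m) ≡ φ m
∑[hasOrder]≡φ {m = m} 1<m (divides q refl) = begin
  ∑[ n < q * m ] 𝟙 (hasOrderℕ? (q * m) n m)
    ≡⟨ cong (λ d → ∑[ n < d ] 𝟙 (hasOrderℕ? (q * m) n m)) (*-comm q m) ⟩
  ∑[ n < m * q ] 𝟙 (hasOrderℕ? (q * m) n m)
    ≡⟨ ∑<-multiples m q off-multiples ⟩
  ∑[ k < m ] 𝟙 (hasOrderℕ? (q * m) (k * q) m)
    ≡⟨ ∑<-cong m (λ k → 𝟙-cong (gcd≡1⇔ ⇔-∘ hasOrder[k*q]⇔coprime {q} {m} {k} 1<m) _ _) ⟩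
  ∑[ k < m ] 𝟙 (gcd k m ≟ 1)
    ≡⟨ φ≡∑[gcd≡1] 1<m ⟨
  φ m
    ∎
  where
  instance
    q≢0 : NonZero q
    q≢0 = m*n≢0⇒m≢0 q
  off-multiples : ∀ n → ¬ q ∣ n → 𝟙 (hasOrderℕ? (q * m) n m) ≡ 0
  off-multiples n q∤n = 𝟙-no (q∤n ∘ order⇒multiple-of-quotient {q} {m}) _
  gcd≡1⇔ : ∀ {k} → Coprime k m ⇔ gcd k m ≡ 1
  gcd≡1⇔ = mk⇔ coprime⇒gcd≡1 gcd≡1⇒coprime

order-parity : ∀ {d m n} .{{_ : NonZero d}} → 1 < m → 2 ∣ d → (m∣d : m ∣ d) →
               HasOrderℕ d n m → n % 2 ≡ quotient m∣d % 2
order-parity {m = m} 1<m 2∣d (divides q refl) o with order⇒multiple-of-quotient {q} {m} o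
... | divides k refl with 2 ∣? q
...   | yes 2∣q = trans (n∣m⇒m%n≡0 _ 2 (∣n⇒∣m*n k 2∣q)) (sym (n∣m⇒m%n≡0 _ 2 2∣q))
...   | no  2∤q = ¬2∣m⇒[m*n]%2≡n%2 q 2∤k
  where
  2∣m : 2 ∣ m
  2∣m with euclidsLemma q m prime[2] 2∣d
  ... | inj₁ 2∣q = ⊥-elim (2∤q 2∣q)
  ... | inj₂ 2∣m = 2∣m
  2∤k : ¬ 2 ∣ k
  2∤k 2∣k with Equivalence.to (hasOrder[k*q]⇔coprime {q} {m} 1<m) o (2∣k , 2∣m)
  ... | ()

module _ (d : ℕ) .{{_ : NonZero d}} where

  δ : ℕ → ℕ
  δ x = 𝟙 (d ∣? x)

  δ-+-multiple : ∀ x {y} → d ∣ y → δ (x + y) ≡ δ x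
  δ-+-multiple x {y} d∣y = 𝟙-cong d∣x+y⇔d∣x _ _
    where
    d∣x+y⇔d∣x : d ∣ x + y ⇔ d ∣ x
    d∣x+y⇔d∣x = mk⇔ (λ d∣x+y → ∣m+n∣m⇒∣n (subst (d ∣_) (+-comm x y) d∣x+y) d∣y)
                    (λ d∣x → ∣m∣n⇒∣m+n d∣x d∣y)

  ∑δ≡1 : ∀ a → ∑[ s < d ] δ (a + s) ≡ 1
  ∑δ≡1 a = begin
    ∑[ s < d ] δ (a + s)  ≡⟨ ∑<-rotate d (λ x → δ-+-multiple x ∣-refl) a ⟩
    ∑< d δ                ≡⟨ cong (λ n → ∑< n δ) (*-identityˡ d) ⟨
    ∑< (1 * d) δ          ≡⟨ ∑<-multiples 1 d (λ y d∤y → 𝟙-no d∤y _) ⟩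
    δ 0 + 0               ≡⟨ cong (_+ 0) (𝟙-yes (d ∣0) _) ⟩
    1                     ∎

  #halves : ℕ → ℕ
  #halves s = ∑[ t < d ] δ (s + 2 * t)

  #halves-+2* : ∀ s a → #halves (s + 2 * a) ≡ #halves s
  #halves-+2* s a = trans (∑<-cong d (λ t → cong δ (+2*-assoc s a t))) (∑<-rotate d d-periodic a)
    where
    +2*-assoc : ∀ s a t → s + 2 * a + 2 * t ≡ s + 2 * (a + t)
    +2*-assoc = solve-∀
    d-periodic : ∀ x → δ (s + 2 * (x + d)) ≡ δ (s + 2 * x)
    d-periodic x = trans (cong δ (+2*-distrib s x d)) (δ-+-multiple (s + 2 * x) (n∣m*n 2))
      where
      +2*-distrib : ∀ s x d → s + 2 * (x + d) ≡ s + 2 * x + 2 * d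
      +2*-distrib = solve-∀

  #halves-+d : ∀ s → #halves (s + d) ≡ #halves s
  #halves-+d s = ∑<-cong d λ t → trans (cong δ (xy∙z≈xz∙y s d (2 * t))) (δ-+-multiple (s + 2 * t) ∣-refl)

  ∑#halves≡d : ∑[ s < d ] #halves s ≡ d
  ∑#halves≡d = begin
    ∑[ s < d ] ∑[ t < d ] δ (s + 2 * t)  ≡⟨ ∑<-comm d d (λ s t → δ (s + 2 * t)) ⟩
    ∑[ t < d ] ∑[ s < d ] δ (s + 2 * t)
      ≡⟨ ∑<-cong d (λ t → ∑<-cong d (λ s → cong δ (+-comm s (2 * t)))) ⟩
    ∑[ t < d ] ∑[ s < d ] δ (2 * t + s)  ≡⟨ ∑<-cong d (λ t → ∑δ≡1 (2 * t)) ⟩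
    ∑[ t < d ] 1                         ≡⟨ ∑<-const d 1 ⟩
    d * 1                                ≡⟨ *-identityʳ d ⟩
    d                                    ∎

  -- Shifts by 2 and by d generate all shifts when d is odd, so #halves is constant.
  #halves≡1 : ¬ 2 ∣ d → ∀ s → #halves s ≡ 1
  #halves≡1 2∤d s = trans (constant s) (*-cancelˡ-≡ _ _ d d*#halves0≡d*1)
    where
    d≡1+[d/2]*2 : d ≡ 1 + d / 2 * 2
    d≡1+[d/2]*2 = trans (m≡m%n+[m/n]*n d 2) (cong (_+ d / 2 * 2) (¬2∣n⇒n%2≡1 2∤d))
    step : ∀ s → #halves (suc s) ≡ #halves s
    step s = begin
      #halves (suc s)                ≡⟨ #halves-+2* (suc s) (d / 2) ⟨
      #halves (suc s + 2 * (d / 2))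
        ≡⟨ cong #halves (trans (rearrange s (d / 2)) (cong (s +_) (sym d≡1+[d/2]*2))) ⟩
      #halves (s + d)                ≡⟨ #halves-+d s ⟩
      #halves s                      ∎
      where
      rearrange : ∀ s h → suc s + 2 * h ≡ s + (1 + h * 2)
      rearrange = solve-∀
    constant : ∀ s → #halves s ≡ #halves 0
    constant zero    = refl
    constant (suc s) = trans (step s) (constant s)
    d*#halves0≡d*1 : d * #halves 0 ≡ d * 1
    d*#halves0≡d*1 = begin
      d * #halves 0           ≡⟨ ∑<-const d (#halves 0) ⟨
      ∑[ s < d ] #halves 0    ≡⟨ ∑<-cong d (sym ∘ constant) ⟩
      ∑[ s < d ] #halves s    ≡⟨ ∑#halves≡d ⟩
      d                       ≡⟨ *-identityʳ d ⟨
      d * 1                   ∎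

  #halves≡0 : 2 ∣ d → ∀ {s} → ¬ 2 ∣ s → #halves s ≡ 0
  #halves≡0 2∣d {s} 2∤s = ∑<-vanishing d λ {t} _ → 𝟙-no (λ d∣s+2t →
    2∤s (∣m+n∣m⇒∣n (subst (2 ∣_) (+-comm s (2 * t)) (∣-trans 2∣d d∣s+2t)) (m∣m*n t))) _

  #halves≡2 : 2 ∣ d → ∀ {s} → 2 ∣ s → #halves s ≡ 2
  #halves≡2 2∣d@(divides e d≡e*2) (divides k refl) = begin
    #halves (k * 2)       ≡⟨ cong #halves (*-comm k 2) ⟩
    #halves (0 + 2 * k)   ≡⟨ #halves-+2* 0 k ⟩
    #halves 0             ≡⟨ *-cancelˡ-≡ _ _ e {{e≢0}} e*#halves0≡e*2 ⟩
    2                     ∎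
    where
    e≢0 : NonZero e
    e≢0 = ≢-nonZero λ e≡0 → ≢-nonZero⁻¹ d (trans d≡e*2 (cong (_* 2) e≡0))
    e*#halves0≡e*2 : e * #halves 0 ≡ e * 2
    e*#halves0≡e*2 = begin
      e * #halves 0                     ≡⟨ cong (e *_) (+-identityʳ (#halves 0)) ⟨
      e * (#halves 0 + 0)               ≡⟨ cong (λ c → e * (#halves 0 + (c + 0))) #halves1≡0 ⟨
      e * (#halves 0 + (#halves 1 + 0)) ≡⟨ ∑<-periodic e 2 2-periodic ⟨
      ∑< (e * 2) #halves                ≡⟨ cong (λ n → ∑< n #halves) d≡e*2 ⟨
      ∑< d #halves                      ≡⟨ ∑#halves≡d ⟩
      d                                 ≡⟨ d≡e*2 ⟩
      e * 2                             ∎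
      where
      2-periodic : ∀ x → #halves (2 + x) ≡ #halves x
      2-periodic x = trans (cong #halves (+-comm 2 x)) (#halves-+2* x 1)
      #halves1≡0 : #halves 1 ≡ 0
      #halves1≡0 = #halves≡0 2∣d λ 2∣1 → >⇒∤ (s<s (s<s z≤n)) 2∣1

  sumᵥ : ∀ {n} → Vec (Fin d) n → ℕ
  sumᵥ xs = Vec.sum (Vec.map toℕ xs)

  doubledSumᵥ : ∀ {n} → Vec (Fin d) n → ℕ
  doubledSumᵥ as = Vec.sum (Vec.map (λ a → 2 * toℕ a) as)

  ∑δ-allVecs-suc : ∀ g s → ∑[ as ∈ allVecs (suc g) d ] δ (s + doubledSumᵥ as)
                         ≡ ∑[ t < d ] ∑[ as ∈ allVecs g d ] δ (s + 2 * t + doubledSumᵥ as)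
  ∑δ-allVecs-suc g s = begin
    ∑[ as ∈ allVecs (suc g) d ] δ (s + doubledSumᵥ as)
      ≡⟨ ∑-allVecs-suc g {d} (λ as → δ (s + doubledSumᵥ as)) ⟩
    ∑[ i ∈ allFin d ] ∑[ as ∈ allVecs g d ] δ (s + (2 * toℕ i + doubledSumᵥ as))
      ≡⟨ ∑-cong (allFin d) (λ i → ∑-cong (allVecs g d) (λ as → cong δ (+-assoc s _ _))) ⟨
    ∑[ i ∈ allFin d ] ∑[ as ∈ allVecs g d ] δ (s + 2 * toℕ i + doubledSumᵥ as)
      ≡⟨ ∑-allFin d (λ t → ∑[ as ∈ allVecs g d ] δ (s + 2 * t + doubledSumᵥ as)) ⟩
    ∑[ t < d ] ∑[ as ∈ allVecs g d ] δ (s + 2 * t + doubledSumᵥ as)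
      ∎

  ∑δ-allVecs : ∀ g s → ∑[ as ∈ allVecs (suc g) d ] δ (s + doubledSumᵥ as) ≡ d ^ g * #halves s
  ∑δ-allVecs zero s = begin
    ∑[ as ∈ allVecs 1 d ] δ (s + doubledSumᵥ as)
      ≡⟨ ∑δ-allVecs-suc zero s ⟩
    ∑[ t < d ] (δ (s + 2 * t + 0) + 0)
      ≡⟨ ∑<-cong d (λ t → trans (+-identityʳ _) (cong δ (+-identityʳ _))) ⟩
    #halves s
      ≡⟨ *-identityˡ (#halves s) ⟨
    1 * #halves s
      ∎
  ∑δ-allVecs (suc g) s = begin
    ∑[ as ∈ allVecs (suc (suc g)) d ] δ (s + doubledSumᵥ as)  ≡⟨ ∑δ-allVecs-suc (suc g) s ⟩
    ∑[ t < d ] ∑[ as ∈ allVecs (suc g) d ] δ (s + 2 * t + doubledSumᵥ as)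
      ≡⟨ ∑<-cong d (λ t → trans (∑δ-allVecs g (s + 2 * t)) (cong (d ^ g *_) (#halves-+2* s t))) ⟩
    ∑[ t < d ] d ^ g * #halves s   ≡⟨ ∑<-const d _ ⟩
    d * (d ^ g * #halves s)        ≡⟨ *-assoc d _ _ ⟨
    d ^ suc g * #halves s          ∎

  HasOrders : ∀ {r} → Vec ℕ r → Vec (Fin d) r → Set
  HasOrders ms xs = ∀ i → HasOrder d (lookup xs i) (lookup ms i)

  hasOrders? : ∀ {r} (ms : Vec ℕ r) → Decidable (HasOrders ms)
  hasOrders? ms xs = all? (λ i → hasOrder? d (lookup xs i) (lookup ms i))

  #orderVectors : ∀ {r} → Vec ℕ r → ℕ
  #orderVectors {r} ms = ∑[ xs ∈ allVecs r d ] 𝟙 (hasOrders? ms xs)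

  hasOrders-∷⇔ : ∀ {r m x} {ms : Vec ℕ r} {xs} →
                 HasOrders (m ∷ ms) (x ∷ xs) ⇔ (HasOrderℕ d (toℕ x) m × HasOrders ms xs)
  hasOrders-∷⇔ = mk⇔ (λ o → o zero , o ∘ suc) λ where
    (o , os) zero    → o
    (o , os) (suc i) → os i

  #orderVectors≡∏φ : ∀ {r} (ms : Vec ℕ r) → (∀ i → 1 < lookup ms i) → (∀ i → lookup ms i ∣ d) →
                     #orderVectors ms ≡ prodVec (Vec.map φ ms)
  #orderVectors≡∏φ [] _ _ = cong (_+ 0) (𝟙-yes {P = HasOrders [] []} (λ ()) (hasOrders? [] []))
  #orderVectors≡∏φ {suc r} (m ∷ ms) 1<ms ms∣d = begin
    ∑[ xs ∈ allVecs (suc r) d ] 𝟙 (hasOrders? (m ∷ ms) xs)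
      ≡⟨ ∑-allVecs-suc r (𝟙 ∘ hasOrders? (m ∷ ms)) ⟩
    ∑[ x ∈ allFin d ] ∑[ xs ∈ allVecs r d ] 𝟙 (hasOrders? (m ∷ ms) (x ∷ xs))
      ≡⟨ ∑-cong (allFin d) (λ x → ∑-cong (allVecs r d) (𝟙-hasOrders-∷ x)) ⟩
    ∑[ x ∈ allFin d ] ∑[ xs ∈ allVecs r d ] 𝟙 (hasOrderℕ? d (toℕ x) m) * 𝟙 (hasOrders? ms xs)
      ≡⟨ ∑-cong (allFin d) (λ x → ∑-*ˡ (allVecs r d) (𝟙 (hasOrderℕ? d (toℕ x) m)) (𝟙 ∘ hasOrders? ms)) ⟩
    ∑[ x ∈ allFin d ] 𝟙 (hasOrderℕ? d (toℕ x) m) * #orderVectors ms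
      ≡⟨ ∑-allFin d (λ n → 𝟙 (hasOrderℕ? d n m) * #orderVectors ms) ⟩
    ∑[ n < d ] 𝟙 (hasOrderℕ? d n m) * #orderVectors ms
      ≡⟨ ∑<-*ʳ d _ _ ⟩
    (∑[ n < d ] 𝟙 (hasOrderℕ? d n m)) * #orderVectors ms
      ≡⟨ cong₂ _*_ (∑[hasOrder]≡φ {d} {m} (1<ms zero) (ms∣d zero))
                   (#orderVectors≡∏φ ms (1<ms ∘ suc) (ms∣d ∘ suc)) ⟩
    φ m * prodVec (Vec.map φ ms)
      ∎
    where
    𝟙-hasOrders-∷ : ∀ x xs →
      𝟙 (hasOrders? (m ∷ ms) (x ∷ xs)) ≡ 𝟙 (hasOrderℕ? d (toℕ x) m) * 𝟙 (hasOrders? ms xs)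
    𝟙-hasOrders-∷ x xs = trans (𝟙-cong (hasOrders-∷⇔ {ms = ms} {xs}) _ _)
                               (𝟙-×-dec (hasOrderℕ? d (toℕ x) m) (hasOrders? ms xs))

  sumᵥ-parity : ∀ {r} (ms : Vec ℕ r) → 2 ∣ d → (∀ i → 1 < lookup ms i) →
                (ms∣d : ∀ i → lookup ms i ∣ d) →
                ∀ {xs} → HasOrders ms xs → sumᵥ xs % 2 ≡ sumQuot ms d ms∣d % 2
  sumᵥ-parity []       _   _    _    {[]}     _ = refl
  sumᵥ-parity (m ∷ ms) 2∣d 1<ms ms∣d {x ∷ xs} o = %-cong-+ {toℕ x} {m′ = quotient (ms∣d zero)} 2
    (order-parity (1<ms zero) 2∣d (ms∣d zero) (o zero))
    (sumᵥ-parity ms 2∣d (1<ms ∘ suc) (ms∣d ∘ suc) {xs} (o ∘ suc))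

  -- The relations x_i^{m_i} = 1 are implied by the order conditions.
  isOrdPresHom⇔ : ∀ {r g} {ms : Vec ℕ r} {xs : Vec (Fin d) r} {as : Vec (Fin d) g} →
                  IsOrdPresHom d ms (xs , as) ⇔ (HasOrders ms xs × d ∣ sumᵥ xs + doubledSumᵥ as)
  isOrdPresHom⇔ = mk⇔
    (λ ((rel , _) , o) → o , m%n≡0⇒n∣m _ d rel)
    (λ (o , d∣rel) → (n∣m⇒m%n≡0 _ d d∣rel , λ i → proj₁ (o i)) , o)

  homO≡∑ : ∀ g {r} (ms : Vec ℕ r) →
           homO (suc g) ms d ≡ ∑[ xs ∈ allVecs r d ] 𝟙 (hasOrders? ms xs) * (d ^ g * #halves (sumᵥ xs))
  homO≡∑ g {r} ms = begin
    homO (suc g) ms d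
      ≡⟨ length-filter≡∑𝟙 (isOrdPresHom? d ms) (cartesianProduct (allVecs r d) (allVecs (suc g) d)) ⟩
    ∑[ p ∈ cartesianProduct (allVecs r d) (allVecs (suc g) d) ] 𝟙 (isOrdPresHom? d ms p)
      ≡⟨ ∑-cartesianProduct (allVecs r d) (allVecs (suc g) d) _ ⟩
    ∑[ xs ∈ allVecs r d ] ∑[ as ∈ allVecs (suc g) d ] 𝟙 (isOrdPresHom? d ms (xs , as))
      ≡⟨ ∑-cong (allVecs r d) (λ xs → ∑-cong (allVecs (suc g) d) (𝟙-isOrdPresHom xs)) ⟩
    ∑[ xs ∈ allVecs r d ] ∑[ as ∈ allVecs (suc g) d ] 𝟙 (hasOrders? ms xs) * δ (sumᵥ xs + doubledSumᵥ as)
      ≡⟨ ∑-cong (allVecs r d) (λ xs →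
           ∑-*ˡ (allVecs (suc g) d) (𝟙 (hasOrders? ms xs)) (δ ∘ (sumᵥ xs +_) ∘ doubledSumᵥ)) ⟩
    ∑[ xs ∈ allVecs r d ] 𝟙 (hasOrders? ms xs) * (∑[ as ∈ allVecs (suc g) d ] δ (sumᵥ xs + doubledSumᵥ as))
      ≡⟨ ∑-cong (allVecs r d) (λ xs → cong (𝟙 (hasOrders? ms xs) *_) (∑δ-allVecs g (sumᵥ xs))) ⟩
    ∑[ xs ∈ allVecs r d ] 𝟙 (hasOrders? ms xs) * (d ^ g * #halves (sumᵥ xs))
      ∎
    where
    𝟙-isOrdPresHom : ∀ xs as →
      𝟙 (isOrdPresHom? d ms (xs , as)) ≡ 𝟙 (hasOrders? ms xs) * δ (sumᵥ xs + doubledSumᵥ as)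
    𝟙-isOrdPresHom xs as = trans (𝟙-cong (isOrdPresHom⇔ {ms = ms} {xs} {as}) _ _)
                                 (𝟙-×-dec (hasOrders? ms xs) (d ∣? _))

  homO≡[d^g*c]*#orderVectors : ∀ g {r} (ms : Vec ℕ r) c →
                               (∀ xs → HasOrders ms xs → #halves (sumᵥ xs) ≡ c) →
                               homO (suc g) ms d ≡ d ^ g * c * #orderVectors ms
  homO≡[d^g*c]*#orderVectors g {r} ms c #halves≡c = trans (homO≡∑ g ms)
    (∑-𝟙-* (hasOrders? ms) (allVecs r d) (d ^ g * c) (λ xs o → cong (d ^ g *_) (#halves≡c xs o)))

proposition3 : (g r : ℕ) → 1 ≤ g → (ms : Vec ℕ r)
    → (∀ (i : Fin r) → 1 < lookup ms i)
    → (∀ (i j : Fin r) → i ≤ᶠ j → lookup ms i ≤ lookup ms j)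
    → (d : ℕ) .{{_ : NonZero d}}
    → ((div : ∀ (i : Fin r) → lookup ms i ∣ d) → ¬ (2 ∣ d)
         → homO g ms d ≡ d ^ (g ∸ 1) * prodVec (Vec.map φ ms))
    × ((div : ∀ (i : Fin r) → lookup ms i ∣ d) → 2 ∣ d → 2 ∣ sumQuot ms d div
         → homO g ms d ≡ 2 * (d ^ (g ∸ 1) * prodVec (Vec.map φ ms)))
    × ((div : ∀ (i : Fin r) → lookup ms i ∣ d) → 2 ∣ d → ¬ (2 ∣ sumQuot ms d div)
         → homO g ms d ≡ 0)
    × (¬ (∀ (i : Fin r) → lookup ms i ∣ d) → homO g ms d ≡ 0)
proposition3 (suc g) _ _ ms 1<ms _ d =
    (λ ms∣d 2∤d → trans (count 1 ms∣d λ xs _ → #halves≡1 d 2∤d (sumᵥ d xs))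
                        (cong (_* ∏φ) (*-identityʳ (d ^ g))))
  , (λ ms∣d 2∣d 2∣Σ → trans (count 2 ms∣d λ xs o → #halves≡2 d 2∣d (from (sum-parity ms∣d 2∣d {xs} o) 2∣Σ))
                            (trans (cong (_* ∏φ) (*-comm (d ^ g) 2)) (*-assoc 2 (d ^ g) ∏φ)))
  , (λ ms∣d 2∣d 2∤Σ → trans (count 0 ms∣d λ xs o → #halves≡0 d 2∣d (2∤Σ ∘ to (sum-parity ms∣d 2∣d {xs} o)))
                            (cong (_* ∏φ) (*-zeroʳ (d ^ g))))
  , (λ ms∤d → trans (homO≡[d^g*c]*#orderVectors d g ms 0 λ _ o → ⊥-elim (ms∤d λ i → m∣d i (o i)))
                    (cong (_* #orderVectors d ms) (*-zeroʳ (d ^ g))))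
  where
  open Equivalence

  ∏φ : ℕ
  ∏φ = prodVec (Vec.map φ ms)

  count : ∀ c → (∀ i → lookup ms i ∣ d) → (∀ xs → HasOrders d ms xs → #halves d (sumᵥ d xs) ≡ c) →
          homO (suc g) ms d ≡ d ^ g * c * ∏φ
  count c ms∣d #halves≡c = trans (homO≡[d^g*c]*#orderVectors d g ms c #halves≡c)
                                 (cong (d ^ g * c *_) (#orderVectors≡∏φ d ms 1<ms ms∣d))

  sum-parity : (ms∣d : ∀ i → lookup ms i ∣ d) → 2 ∣ d → ∀ {xs} → HasOrders d ms xs →
               2 ∣ sumᵥ d xs ⇔ 2 ∣ sumQuot ms d ms∣d
  sum-parity ms∣d 2∣d {xs} o = %-≡⇒∣⇔ 2 (sumᵥ-parity d ms 2∣d 1<ms ms∣d {xs} o)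

  m∣d : ∀ i {x} → HasOrder d x (lookup ms i) → lookup ms i ∣ d
  m∣d i = order∣modulus {d} {{m≢0 = >-nonZero (<-trans z<s (1<ms i))}}
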